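{- Let $\mathbf{C}$ be a category with an $\mathcal{M}$-partial map classifier $(T,\eta)$ for a stable system of monics $\mathcal{M}$. Let $\rho$ be an AGREE rule $L\xleftarrow{l}K\xrightarrow{r}R$ with $t_K:K\to K'$ in $\mathcal{M}$, and let $[\![\rho]\!]$ be the PBPO$^+$ rule with the same $l,r,t_K$, with $L'=T(L)$, $t_L=\eta_L$ and $l'=[t_K,l]:K'\to T(L)$. Then for every match $m:L\to G_L$ in $\mathcal{M}$ and all objects $G_L,G_R$: $G_L\Rightarrow^{\rho,m}_{\mathrm{AGREE}}G_R$ if and only if $G_L\Rightarrow^{[\![\rho]\!],m}_{\mathrm{PBPO}^+}G_R$.
   Context: A stable system of monics $\mathcal{M}$ is a class of monomorphisms containing all isomorphisms, closed under composition and stable under pullback. An $\mathcal{M}$-partial map classifier $(T,\eta)$ is a functor $T:\mathbf{C}\to\mathbf{C}$ with a natural transformation $\eta:\mathrm{Id}\to T$, each $\eta_X\in\mathcal{M}$, such that for every span $A\xleftarrow{m}X\xrightarrow{f}B$ with $m\in\mathcal{M}$ there is a unique $[m,f]:A\to T(B)$ making $\eta_B\circ f=[m,f]\circ m$ a pullback (so in particular $\eta_L\circ l=[t_K,l]\circ t_K$ is a pullback). AGREE step $G_L\Rightarrow^{\rho,m}_{\mathrm{AGREE}}G_R$ ($m\in\mathcal{M}$): $G_L\xleftarrow{g_L}G_K\to K'$ is a pullback of $G_L\xrightarrow{[m,1_L]}T(L)\xleftarrow{[t_K,l]}K'$, $u:K\to G_K$ is the induced morphism, and $G_R$ is a pushout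 of $G_K\xleftarrow{u}K\xrightarrow{r}R$. PBPO$^+$ rule: $l:K\to L$, $r:K\to R$, $t_L:L\to L'$, $t_K:K\to K'$, $l':K'\to L'$ with $t_Ll=l't_K$ a pullback. $G_L\Rightarrow^{\tau,m}_{\mathrm{PBPO}^+}G_R$ if there is $\alpha:G_L\to L'$ with $\alpha m=t_L$ and $L\xleftarrow{1_L}L\xrightarrow{m}G_L$ a pullback of $L\xrightarrow{t_L}L'\xleftarrow{\alpha}G_L$, $G_L\xleftarrow{g_L}G_K\xrightarrow{u'}K'$ a pullback of $\alpha,l'$, $u$ the unique morphism with $u'u=t_K$, and $G_R$ a pushout of $G_K\xleftarrow{u}K\xrightarrow{r}R$. -}

module Defs where

open import Level using (Level; _⊔_; suc)
open import Data.Product using (Σ; _×_; _,_; ∃-syntax)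
open import Relation.Binary using (IsEquivalence)

record Category (o ℓ e : Level) : Set (suc (o ⊔ ℓ ⊔ e)) where
  infixr 9 _∘_
  infix  4 _≈_
  field
    Obj       : Set o
    _⇒_       : Obj → Obj → Set ℓ
    _≈_       : ∀ {A B} → A ⇒ B → A ⇒ B → Set e
    id        : ∀ {A} → A ⇒ A
    _∘_       : ∀ {A B C} → B ⇒ C → A ⇒ B → A ⇒ C
    ≈-equiv   : ∀ {A B} → IsEquivalence (_≈_ {A} {B})
    ∘-resp-≈  : ∀ {A B C} {f h : B ⇒ C} {g i : A ⇒ B} →
                f ≈ h → g ≈ i → f ∘ g ≈ h ∘ i
    assoc     : ∀ {A B C D} {f : A ⇒ B} {g : B ⇒ C} {h : C ⇒ D} →
                (h ∘ g) ∘ f ≈ h ∘ (g ∘ f)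
    identityˡ : ∀ {A B} {f : A ⇒ B} → id ∘ f ≈ f
    identityʳ : ∀ {A B} {f : A ⇒ B} → f ∘ id ≈ f

module _ {o ℓ e : Level} (C : Category o ℓ e) where
  open Category C

  IsMono : ∀ {A B} → A ⇒ B → Set (o ⊔ ℓ ⊔ e)
  IsMono {A} f = ∀ {X} (g h : X ⇒ A) → f ∘ g ≈ f ∘ h → g ≈ h

  IsIso : ∀ {A B} → A ⇒ B → Set (ℓ ⊔ e)
  IsIso {A} {B} f = Σ (B ⇒ A) λ g → (g ∘ f ≈ id) × (f ∘ g ≈ id)

  record IsPullback {A B Cod P : Obj} (f : A ⇒ Cod) (g : B ⇒ Cod)
                    (p : P ⇒ A) (q : P ⇒ B) : Set (o ⊔ ℓ ⊔ e) where
    field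
      commute   : f ∘ p ≈ g ∘ q
      universal : ∀ {X} (h : X ⇒ A) (k : X ⇒ B) → f ∘ h ≈ g ∘ k →
                  Σ (X ⇒ P) λ u → (p ∘ u ≈ h) × (q ∘ u ≈ k)
      unique    : ∀ {X} (u v : X ⇒ P) → p ∘ u ≈ p ∘ v → q ∘ u ≈ q ∘ v →
                  u ≈ v

  record IsPushout {Dom A B P : Obj} (f : Dom ⇒ A) (g : Dom ⇒ B)
                   (p : A ⇒ P) (q : B ⇒ P) : Set (o ⊔ ℓ ⊔ e) where
    field
      commute   : p ∘ f ≈ q ∘ g
      universal : ∀ {X} (h : A ⇒ X) (k : B ⇒ X) → h ∘ f ≈ k ∘ g →
                  Σ (P ⇒ X) λ u → (u ∘ p ≈ h) × (u ∘ q ≈ k)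
      unique    : ∀ {X} (u v : P ⇒ X) → u ∘ p ≈ v ∘ p → u ∘ q ≈ v ∘ q →
                  u ≈ v

  record StableSystem (m : Level) : Set (o ⊔ ℓ ⊔ e ⊔ suc m) where
    field
      M        : ∀ {A B} → A ⇒ B → Set m
      M-mono   : ∀ {A B} {f : A ⇒ B} → M f → IsMono f
      M-iso    : ∀ {A B} {f : A ⇒ B} → IsIso f → M f
      M-comp   : ∀ {A B D} {f : A ⇒ B} {g : B ⇒ D} → M f → M g → M (g ∘ f)
      M-stable : ∀ {A B D P} {f : A ⇒ D} {g : B ⇒ D} {p : P ⇒ A} {q : P ⇒ B} →
                 M f → IsPullback f g p q → M q

  record Functor : Set (o ⊔ ℓ ⊔ e) where
    field
      F₀           : Obj → Obj
      F₁           : ∀ {A B} → A ⇒ B → F₀ A ⇒ F₀ B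
      F-resp-≈     : ∀ {A B} {f g : A ⇒ B} → f ≈ g → F₁ f ≈ F₁ g
      identity     : ∀ {A} → F₁ (id {A}) ≈ id
      homomorphism : ∀ {A B D} {f : A ⇒ B} {g : B ⇒ D} →
                     F₁ (g ∘ f) ≈ F₁ g ∘ F₁ f

  record NatFromId (T : Functor) : Set (o ⊔ ℓ ⊔ e) where
    open Functor T
    field
      η   : ∀ X → X ⇒ F₀ X
      nat : ∀ {A B} (f : A ⇒ B) → η B ∘ f ≈ F₁ f ∘ η A

  record PartialMapClassifier {m : Level} (𝓜 : StableSystem m)
         : Set (o ⊔ ℓ ⊔ e ⊔ m) where
    open StableSystem 𝓜
    field
      T      : Functor
      ηT     : NatFromId T
    open Functor T public
    open NatFromId ηT public
    field
      η-M       : ∀ X → M (η X)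
      classify  : ∀ {A X B} (mm : X ⇒ A) → M mm → (f : X ⇒ B) → A ⇒ F₀ B
      classify-pb : ∀ {A X B} (mm : X ⇒ A) (mM : M mm) (f : X ⇒ B) →
                    IsPullback (classify mm mM f) (η B) mm f
      classify-unique : ∀ {A X B} (mm : X ⇒ A) (mM : M mm) (f : X ⇒ B)
                        (h : A ⇒ F₀ B) → IsPullback h (η B) mm f →
                        h ≈ classify mm mM f

  -- PBPO+ step  G_L ⇒^{τ,m} G_R  for the rule
  -- τ = (l : K → L, r : K → R, t_L : L → L', t_K : K → K', l' : K' → L').
  -- (Well-formedness of the rule, i.e. t_L l = l' t_K a pullback, is a
  -- property of the rule and is not part of the step relation.)
  PBPOStep : ∀ {K L R L' K'} (l : K ⇒ L) (r : K ⇒ R) (tL : L ⇒ L')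
             (tK : K ⇒ K') (l' : K' ⇒ L') {GL : Obj} (mt : L ⇒ GL)
             (GR : Obj) → Set (o ⊔ ℓ ⊔ e)
  PBPOStep {K} {L} {R} {L'} {K'} l r tL tK l' {GL} mt GR =
    Σ (GL ⇒ L') λ α →
      (α ∘ mt ≈ tL) ×
      (IsPullback tL α id mt ×
      Σ Obj λ GK → Σ (GK ⇒ GL) λ gL → Σ (GK ⇒ K') λ u' →
        IsPullback α l' gL u' ×
        Σ (K ⇒ GK) λ u →
          (u' ∘ u ≈ tK) ×
          ((∀ (v : K ⇒ GK) → u' ∘ v ≈ tK → v ≈ u) ×
          Σ (GK ⇒ GR) λ gR → Σ (R ⇒ GR) λ w →
            IsPushout u r gR w))

  module _ {m : Level} {𝓜 : StableSystem m}
           (P : PartialMapClassifier 𝓜) where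
    open StableSystem 𝓜
    open PartialMapClassifier P

    AgreeStep : ∀ {K L R K'} (l : K ⇒ L) (r : K ⇒ R) (tK : K ⇒ K')
                (tKM : M tK) {GL : Obj} (mt : L ⇒ GL) (mM : M mt)
                (GR : Obj) → Set (o ⊔ ℓ ⊔ e)
    AgreeStep {K} {L} {R} {K'} l r tK tKM {GL} mt mM GR =
      Σ Obj λ GK → Σ (GK ⇒ GL) λ gL → Σ (GK ⇒ K') λ k →
        IsPullback (classify mt mM id) (classify tK tKM l) gL k ×
        Σ (K ⇒ GK) λ u →
          (gL ∘ u ≈ mt ∘ l) × ((k ∘ u ≈ tK) ×
          Σ (GK ⇒ GR) λ gR → Σ (R ⇒ GR) λ w →
            IsPushout u r gR w)

-- The two steps differ only in the morphism α : G_L → T(L) along which K'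
-- is pulled back. The PBPO⁺ condition that L ← L → G_L is a pullback of
-- η_L and α says precisely that α classifies the partial map (m, 1_L), so
-- α = [m, 1_L] by uniqueness of classifying maps. Moreover, since that
-- classifying square has an identity leg and η_L ∘ l = [t_K, l] ∘ t_K, any
-- v : K → G_K with u' ∘ v = t_K already satisfies g_L ∘ v = m ∘ l; hence
-- the morphism induced by the AGREE pullback is exactly the unique one
-- demanded by PBPO⁺.
module Submission where

open import Level using (Level)
open import Function.Bundles using (_⇔_; mk⇔)
open import Data.Product using (_,_)
open import Relation.Binary using (IsEquivalence; Setoid)
import Relation.Binary.Reasoning.Setoid as SetoidReasoning
open import Defs

module PullbackProperties {o ℓ e : Level} (C : Category o ℓ e) where
  open Category C

  hom-setoid : Obj → Obj → Setoid ℓ e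
  hom-setoid A B = record { isEquivalence = ≈-equiv {A} {B} }

  module ≈ {A B : Obj} = IsEquivalence (≈-equiv {A} {B})
  module HomReasoning {A B : Obj} = SetoidReasoning (hom-setoid A B)

  IsPullback-swap : ∀ {A B D P} {f : A ⇒ D} {g : B ⇒ D} {p : P ⇒ A} {q : P ⇒ B} →
                    IsPullback C f g p q → IsPullback C g f q p
  IsPullback-swap pb = record
    { commute   = ≈.sym commute
    ; universal = λ h k hk → let (u , pu , qu) = universal k h (≈.sym hk) in u , qu , pu
    ; unique    = λ u v qu≈qv pu≈pv → unique u v pu≈pv qu≈qv
    }
    where open IsPullback pb

  IsPullback-resp-≈ˡ : ∀ {A B D P} {f f' : A ⇒ D} {g : B ⇒ D} {p : P ⇒ A} {q : P ⇒ B} →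
                       f ≈ f' → IsPullback C f g p q → IsPullback C f' g p q
  IsPullback-resp-≈ˡ f≈f' pb = record
    { commute   = ≈.trans (∘-resp-≈ (≈.sym f≈f') ≈.refl) commute
    ; universal = λ h k f'h≈gk → universal h k (≈.trans (∘-resp-≈ f≈f' ≈.refl) f'h≈gk)
    ; unique    = unique
    }
    where open IsPullback pb

  IsPullback-id-factor : ∀ {A L D X} {a : A ⇒ D} {b : L ⇒ D} {m : L ⇒ A} →
                         IsPullback C a b m id → (x : X ⇒ A) (y : X ⇒ L) →
                         a ∘ x ≈ b ∘ y → x ≈ m ∘ y
  IsPullback-id-factor {m = m} pb x y ax≈by =
    let (w , mw≈x , w≈y) = IsPullback.universal pb x y ax≈by
    in ≈.trans (≈.sym mw≈x) (∘-resp-≈ ≈.refl (≈.trans (≈.sym identityˡ) w≈y))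

  IsPullback-id-factor-over : ∀ {A L D K K' GK} {a : A ⇒ D} {b : L ⇒ D} {m : L ⇒ A}
    {l : K ⇒ L} {tK : K ⇒ K'} {l' : K' ⇒ D} {gL : GK ⇒ A} {u' : GK ⇒ K'} →
    IsPullback C a b m id → l' ∘ tK ≈ b ∘ l → a ∘ gL ≈ l' ∘ u' →
    (v : K ⇒ GK) → u' ∘ v ≈ tK → gL ∘ v ≈ m ∘ l
  IsPullback-id-factor-over {a = a} {b} {l = l} {tK} {l'} {gL} {u'} pb l'tK≈bl agL≈l'u' v u'v≈tK =
    IsPullback-id-factor pb (gL ∘ v) l (begin
      a ∘ (gL ∘ v)   ≈⟨ ≈.sym assoc ⟩
      (a ∘ gL) ∘ v   ≈⟨ ∘-resp-≈ agL≈l'u' ≈.refl ⟩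
      (l' ∘ u') ∘ v  ≈⟨ assoc ⟩
      l' ∘ (u' ∘ v)  ≈⟨ ∘-resp-≈ ≈.refl u'v≈tK ⟩
      l' ∘ tK        ≈⟨ l'tK≈bl ⟩
      b ∘ l          ∎)
    where open HomReasoning

module AgreeAsPBPO {o ℓ e mℓ : Level} (C : Category o ℓ e)
                   {𝓜 : StableSystem C mℓ} (P : PartialMapClassifier C 𝓜) where
  open Category C
  open StableSystem 𝓜
  open PartialMapClassifier P
  open PullbackProperties C

  module _ {K L R K' : Obj} (l : K ⇒ L) (r : K ⇒ R) (tK : K ⇒ K') (tKM : M tK)
           {GL : Obj} (mt : L ⇒ GL) (mM : M mt) (GR : Obj) where

    private
      classify-commute : classify tK tKM l ∘ tK ≈ η L ∘ l
      classify-commute = IsPullback.commute (classify-pb tK tKM l)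

      match-pb : IsPullback C (classify mt mM id) (η L) mt id
      match-pb = classify-pb mt mM id

    agree⇒pbpo : AgreeStep C P l r tK tKM mt mM GR →
                 PBPOStep C l r (η L) tK (classify tK tKM l) mt GR
    agree⇒pbpo (GK , gL , k , pb , u , gLu≈ml , ku≈tK , gR , w , po) =
      classify mt mM id
      , ≈.trans (IsPullback.commute match-pb) identityʳ
      , IsPullback-swap match-pb
      , GK , gL , k , pb , u , ku≈tK
      , (λ v kv≈tK → IsPullback.unique pb v u
           (≈.trans (IsPullback-id-factor-over match-pb classify-commute (IsPullback.commute pb) v kv≈tK)
                    (≈.sym gLu≈ml))
           (≈.trans kv≈tK (≈.sym ku≈tK)))
      , gR , w , po

    pbpo⇒agree : PBPOStep C l r (η L) tK (classify tK tKM l) mt GR →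
                 AgreeStep C P l r tK tKM mt mM GR
    pbpo⇒agree (α , _ , α-pb , GK , gL , u' , pb , u , u'u≈tK , _ , gR , w , po) =
      GK , gL , u' , IsPullback-resp-≈ˡ α≈classify pb , u
      , IsPullback-id-factor-over (IsPullback-swap α-pb) classify-commute (IsPullback.commute pb) u u'u≈tK
      , u'u≈tK , gR , w , po
      where
      α≈classify : α ≈ classify mt mM id
      α≈classify = classify-unique mt mM id α (IsPullback-swap α-pb)

proposition17 : ∀ {o ℓ e mℓ : Level} (C : Category o ℓ e)
  (𝓜 : StableSystem C mℓ) (P : PartialMapClassifier C 𝓜) →
  let open Category C
      open StableSystem 𝓜
      open PartialMapClassifier P
  in ∀ {K L R K' : Obj} (l : K ⇒ L) (r : K ⇒ R) (tK : K ⇒ K') (tKM : M tK)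
       {GL : Obj} (mt : L ⇒ GL) (mM : M mt) (GR : Obj) →
     AgreeStep C P l r tK tKM mt mM GR
       ⇔ PBPOStep C l r (η L) tK (classify tK tKM l) mt GR
proposition17 C 𝓜 P l r tK tKM mt mM GR =
  mk⇔ (agree⇒pbpo l r tK tKM mt mM GR) (pbpo⇒agree l r tK tKM mt mM GR)
  where open AgreeAsPBPO C P
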